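{- A dagger category $(\mathbb{X},\dagger)$ is Moore-Penrose complete if and only if every map in $\mathbb{X}$ has a generalized compact singular value decomposition.
   Context: Composition is in diagrammatic order. A dagger category is a category with an identity-on-objects contravariant involutive functor $\dagger$. Isometry: $s: A\to B$ with $ss^\dagger = 1_A$; coisometry: $r: A\to B$ with $r^\dagger r = 1_B$. A Moore-Penrose inverse of $f: A\to B$ is $f^\circ: B\to A$ with $ff^\circ f = f$, $f^\circ f f^\circ = f^\circ$, $(ff^\circ)^\dagger = ff^\circ$, $(f^\circ f)^\dagger = f^\circ f$. A $\dagger$-idempotent $e$ ($ee=e=e^\dagger$) $\dagger$-splits if $e = rr^\dagger$ with $r^\dagger r = 1$. $f$ is Moore-Penrose split if it has a Moore-Penrose inverse $f^\circ$ and $ff^\circ$, $f^\circ f$ both $\dagger$-split; the dagger category is Moore-Penrose complete if every map is Moore-Penrose split. A generalized compact singular value decomposition of $f: A\to B$ is a triple $(r: A\to X, d: X\to Y, s: Y\to B)$ with $r$ a coisometry, $d$ an isomorphism, $s$ an isometry and $f = rds$. -}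

module Defs where

open import Level using (Level; _⊔_; suc)
open import Data.Product using (Σ; _×_; _,_; ∃-syntax)
open import Relation.Binary using (IsEquivalence)

-- A (locally small, setoid-enriched) category, with composition in
-- DIAGRAMMATIC order:  f ⨾ g : A ⇒ C  for  f : A ⇒ B, g : B ⇒ C.
record Category (o ℓ e : Level) : Set (suc (o ⊔ ℓ ⊔ e)) where
  infix  4 _≈_
  infixr 9 _⨾_
  field
    Obj   : Set o
    _⇒_   : Obj → Obj → Set ℓ
    _≈_   : ∀ {A B} → A ⇒ B → A ⇒ B → Set e
    id    : ∀ {A} → A ⇒ A
    _⨾_   : ∀ {A B C} → A ⇒ B → B ⇒ C → A ⇒ C
    ≈-equiv : ∀ {A B} → IsEquivalence (_≈_ {A} {B})
    ⨾-resp-≈ : ∀ {A B C} {f f' : A ⇒ B} {g g' : B ⇒ C} →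
               f ≈ f' → g ≈ g' → f ⨾ g ≈ f' ⨾ g'
    assoc   : ∀ {A B C D} (f : A ⇒ B) (g : B ⇒ C) (h : C ⇒ D) →
              (f ⨾ g) ⨾ h ≈ f ⨾ (g ⨾ h)
    identityˡ : ∀ {A B} (f : A ⇒ B) → id ⨾ f ≈ f
    identityʳ : ∀ {A B} (f : A ⇒ B) → f ⨾ id ≈ f

record DaggerCategory (o ℓ e : Level) : Set (suc (o ⊔ ℓ ⊔ e)) where
  field
    cat : Category o ℓ e
  open Category cat public
  field
    _† : ∀ {A B} → A ⇒ B → B ⇒ A
    †-resp-≈ : ∀ {A B} {f g : A ⇒ B} → f ≈ g → (f †) ≈ (g †)
    †-identity : ∀ {A} → ((id {A}) †) ≈ id
    †-homomorphism : ∀ {A B C} (f : A ⇒ B) (g : B ⇒ C) →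
                     ((f ⨾ g) †) ≈ (g †) ⨾ (f †)
    †-involutive : ∀ {A B} (f : A ⇒ B) → ((f †) †) ≈ f

module _ {o ℓ e : Level} (X : DaggerCategory o ℓ e) where
  open DaggerCategory X

  IsIsometry : ∀ {A B} → A ⇒ B → Set e
  IsIsometry s = s ⨾ (s †) ≈ id

  IsCoisometry : ∀ {A B} → A ⇒ B → Set e
  IsCoisometry r = (r †) ⨾ r ≈ id

  IsIso : ∀ {A B} → A ⇒ B → Set (ℓ ⊔ e)
  IsIso {A} {B} d = Σ (B ⇒ A) λ d⁻¹ → (d ⨾ d⁻¹ ≈ id) × (d⁻¹ ⨾ d ≈ id)

  IsMPInverse : ∀ {A B} → A ⇒ B → B ⇒ A → Set e
  IsMPInverse f f° =
    (f ⨾ f° ⨾ f ≈ f) × (f° ⨾ f ⨾ f° ≈ f°) ×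
    (((f ⨾ f°) †) ≈ f ⨾ f°) × (((f° ⨾ f) †) ≈ f° ⨾ f)

  †-Splits : ∀ {A} → A ⇒ A → Set (o ⊔ ℓ ⊔ e)
  †-Splits {A} ε = Σ Obj λ X' → Σ (A ⇒ X') λ r → (ε ≈ r ⨾ (r †)) × IsCoisometry r

  IsMPSplit : ∀ {A B} → A ⇒ B → Set (o ⊔ ℓ ⊔ e)
  IsMPSplit {A} {B} f = Σ (B ⇒ A) λ f° →
    IsMPInverse f f° × †-Splits (f ⨾ f°) × †-Splits (f° ⨾ f)

  MPComplete : Set (o ⊔ ℓ ⊔ e)
  MPComplete = ∀ {A B} (f : A ⇒ B) → IsMPSplit f

  HasGCSVD : ∀ {A B} → A ⇒ B → Set (o ⊔ ℓ ⊔ e)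
  HasGCSVD {A} {B} f =
    Σ Obj λ X' → Σ Obj λ Y → Σ (A ⇒ X') λ r → Σ (X' ⇒ Y) λ d → Σ (Y ⇒ B) λ s →
      IsCoisometry r × IsIso d × IsIsometry s × (f ≈ r ⨾ d ⨾ s)

{-# OPTIONS --safe #-}

-- If f° is a Moore-Penrose inverse of f with f f° = r r† and f° f = q q†, then
-- d = r† f q is invertible with inverse q† f° r, and f = r d q†.  Conversely, if
-- f = r d s then f° = s† d⁻¹ r† is a Moore-Penrose inverse with f f° = r r† and
-- f° f = s† s, so both projections †-split through the given (co)isometries.
module Submission where

open import Defs
open import Level using (Level)
open import Function.Bundles using (_⇔_; mk⇔)
open import Data.Product using (_,_)
open import Relation.Binary using (IsEquivalence; Setoid)
import Relation.Binary.Reasoning.Setoid as SetoidReasoning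

module _ {o ℓ e : Level} (X : DaggerCategory o ℓ e) where
  open DaggerCategory X

  private
    module ≈ {A B : Obj} = IsEquivalence (≈-equiv {A} {B})

    hom : Obj → Obj → Setoid ℓ e
    hom A B = record { isEquivalence = ≈-equiv {A} {B} }

    module HomReasoning {A B : Obj} = SetoidReasoning (hom A B)
    open HomReasoning

    infixr 4 _⟩⨾⟨_
    _⟩⨾⟨_ : ∀ {A B C} {f f' : A ⇒ B} {g g' : B ⇒ C} → f ≈ f' → g ≈ g' → f ⨾ g ≈ f' ⨾ g'
    _⟩⨾⟨_ = ⨾-resp-≈

    assoc⁻¹ : ∀ {A B C D} (f : A ⇒ B) (g : B ⇒ C) (h : C ⇒ D) → f ⨾ (g ⨾ h) ≈ (f ⨾ g) ⨾ h
    assoc⁻¹ f g h = ≈.sym (assoc f g h)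

  cancelInner : ∀ {A B C D} {a : A ⇒ B} {b : B ⇒ C} {c : C ⇒ B} (x : B ⇒ D) →
                b ⨾ c ≈ id → (a ⨾ b) ⨾ (c ⨾ x) ≈ a ⨾ x
  cancelInner {a = a} {b} {c} x bc≈id = begin
    (a ⨾ b) ⨾ (c ⨾ x)  ≈⟨ assoc a b (c ⨾ x) ⟩
    a ⨾ (b ⨾ (c ⨾ x))  ≈⟨ ≈.refl ⟩⨾⟨ assoc⁻¹ b c x ⟩
    a ⨾ ((b ⨾ c) ⨾ x)  ≈⟨ ≈.refl ⟩⨾⟨ bc≈id ⟩⨾⟨ ≈.refl ⟩
    a ⨾ (id ⨾ x)       ≈⟨ ≈.refl ⟩⨾⟨ identityˡ x ⟩
    a ⨾ x              ∎

  cancelMiddle : ∀ {A B C D} {a : A ⇒ B} {b : B ⇒ C} {c : C ⇒ D} {c' : D ⇒ C} {b' : C ⇒ B}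
                 (a' : B ⇒ A) → c ⨾ c' ≈ id → b ⨾ b' ≈ id →
                 (a ⨾ (b ⨾ c)) ⨾ (c' ⨾ (b' ⨾ a')) ≈ a ⨾ a'
  cancelMiddle {a = a} {b} {c} {c'} {b'} a' cc'≈id bb'≈id = begin
    (a ⨾ (b ⨾ c)) ⨾ (c' ⨾ (b' ⨾ a'))  ≈⟨ assoc⁻¹ a b c ⟩⨾⟨ ≈.refl ⟩
    ((a ⨾ b) ⨾ c) ⨾ (c' ⨾ (b' ⨾ a'))  ≈⟨ cancelInner (b' ⨾ a') cc'≈id ⟩
    (a ⨾ b) ⨾ (b' ⨾ a')               ≈⟨ cancelInner a' bb'≈id ⟩
    a ⨾ a'                            ∎

  h⨾h†-selfAdjoint : ∀ {A B} (h : A ⇒ B) → ((h ⨾ h †) †) ≈ h ⨾ h †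
  h⨾h†-selfAdjoint h = ≈.trans (†-homomorphism h (h †)) (†-involutive h ⟩⨾⟨ ≈.refl)

  coisometry⇒†-isometry : ∀ {A B} {r : A ⇒ B} → IsCoisometry X r → IsIsometry X (r †)
  coisometry⇒†-isometry {r = r} = ≈.trans (≈.refl ⟩⨾⟨ †-involutive r)

  isometry⇒†-coisometry : ∀ {A B} {s : A ⇒ B} → IsIsometry X s → IsCoisometry X (s †)
  isometry⇒†-coisometry {s = s} = ≈.trans (†-involutive s ⟩⨾⟨ ≈.refl)

  projection⇒fgf≈f : ∀ {A B P} {f : A ⇒ B} {g : B ⇒ A} {p : A ⇒ P} (x : P ⇒ B) →
                     f ⨾ g ≈ p ⨾ p † → IsCoisometry X p → f ≈ p ⨾ x → f ⨾ (g ⨾ f) ≈ f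
  projection⇒fgf≈f {f = f} {g} {p} x fg≈pp† p†p≈id f≈px = begin
    f ⨾ (g ⨾ f)           ≈⟨ assoc⁻¹ f g f ⟩
    (f ⨾ g) ⨾ f           ≈⟨ fg≈pp† ⟩⨾⟨ f≈px ⟩
    (p ⨾ p †) ⨾ (p ⨾ x)   ≈⟨ cancelInner x p†p≈id ⟩
    p ⨾ x                 ≈⟨ ≈.sym f≈px ⟩
    f                     ∎

  projection⇒selfAdjoint : ∀ {A P} {π : A ⇒ A} {p : A ⇒ P} → π ≈ p ⨾ p † → (π †) ≈ π
  projection⇒selfAdjoint {p = p} π≈pp† =
    ≈.trans (†-resp-≈ π≈pp†) (≈.trans (h⨾h†-selfAdjoint p) (≈.sym π≈pp†))

  gcsvd⇒MPSplit : ∀ {A B} {f : A ⇒ B} → HasGCSVD X f → IsMPSplit X f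
  gcsvd⇒MPSplit {f = f} (_ , _ , r , d , s , r-co , (d⁻¹ , dd⁻¹≈id , d⁻¹d≈id) , s-iso , f≈rds) =
    f° , (fg , gf , projection⇒selfAdjoint ff°≈rr† , projection⇒selfAdjoint f°f≈s†s††) ,
    (_ , r , ff°≈rr† , r-co) , (_ , s † , f°f≈s†s†† , s†-co)
    where
    f° = s † ⨾ (d⁻¹ ⨾ r †)
    s†-co = isometry⇒†-coisometry s-iso

    ff°≈rr† : f ⨾ f° ≈ r ⨾ r †
    ff°≈rr† = ≈.trans (f≈rds ⟩⨾⟨ ≈.refl) (cancelMiddle (r †) s-iso dd⁻¹≈id)

    f°f≈s†s†† : f° ⨾ f ≈ s † ⨾ (s †) †
    f°f≈s†s†† = begin
      f° ⨾ f                         ≈⟨ ≈.refl ⟩⨾⟨ f≈rds ⟩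
      f° ⨾ (r ⨾ (d ⨾ s))             ≈⟨ cancelMiddle s r-co d⁻¹d≈id ⟩
      s † ⨾ s                        ≈⟨ ≈.refl ⟩⨾⟨ ≈.sym (†-involutive s) ⟩
      s † ⨾ (s †) †                  ∎

    fg : f ⨾ (f° ⨾ f) ≈ f
    fg = projection⇒fgf≈f (d ⨾ s) ff°≈rr† r-co f≈rds

    gf : f° ⨾ (f ⨾ f°) ≈ f°
    gf = projection⇒fgf≈f (d⁻¹ ⨾ r †) f°f≈s†s†† s†-co ≈.refl

  -- No Moore-Penrose equation is needed: f q q† f° = (f f°)(f f°) = (r r†)(r r†).
  -- Exchanging (f, r) with (f°, q) gives the other inverse law.
  splitCore-inverse : ∀ {A B R Q} {f : A ⇒ B} {f° : B ⇒ A} {r : A ⇒ R} {q : B ⇒ Q} →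
                      f ⨾ f° ≈ r ⨾ r † → f° ⨾ f ≈ q ⨾ q † →
                      IsCoisometry X r → (r † ⨾ (f ⨾ q)) ⨾ (q † ⨾ (f° ⨾ r)) ≈ id
  splitCore-inverse {f = f} {f°} {r} {q} ff°≈rr† f°f≈qq† r†r≈id = begin
    (r † ⨾ (f ⨾ q)) ⨾ (q † ⨾ (f° ⨾ r))   ≈⟨ assoc⁻¹ (r †) f q ⟩⨾⟨ ≈.refl ⟩
    ((r † ⨾ f) ⨾ q) ⨾ (q † ⨾ (f° ⨾ r))   ≈⟨ assoc _ q _ ⟩
    (r † ⨾ f) ⨾ (q ⨾ (q † ⨾ (f° ⨾ r)))   ≈⟨ ≈.refl ⟩⨾⟨ assoc⁻¹ q (q †) _ ⟩
    (r † ⨾ f) ⨾ ((q ⨾ q †) ⨾ (f° ⨾ r))   ≈⟨ ≈.refl ⟩⨾⟨ ≈.sym f°f≈qq† ⟩⨾⟨ ≈.refl ⟩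
    (r † ⨾ f) ⨾ ((f° ⨾ f) ⨾ (f° ⨾ r))    ≈⟨ ≈.refl ⟩⨾⟨ assoc f° f _ ⟩
    (r † ⨾ f) ⨾ (f° ⨾ (f ⨾ (f° ⨾ r)))    ≈⟨ assoc (r †) f _ ⟩
    r † ⨾ (f ⨾ (f° ⨾ (f ⨾ (f° ⨾ r))))    ≈⟨ ≈.refl ⟩⨾⟨ assoc⁻¹ f f° _ ⟩
    r † ⨾ ((f ⨾ f°) ⨾ (f ⨾ (f° ⨾ r)))    ≈⟨ ≈.refl ⟩⨾⟨ ≈.refl ⟩⨾⟨ assoc⁻¹ f f° r ⟩
    r † ⨾ ((f ⨾ f°) ⨾ ((f ⨾ f°) ⨾ r))    ≈⟨ ≈.refl ⟩⨾⟨ ff°≈rr† ⟩⨾⟨ ff°≈rr† ⟩⨾⟨ ≈.refl ⟩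
    r † ⨾ ((r ⨾ r †) ⨾ ((r ⨾ r †) ⨾ r))  ≈⟨ ≈.refl ⟩⨾⟨ ≈.refl ⟩⨾⟨ assoc r (r †) r ⟩
    r † ⨾ ((r ⨾ r †) ⨾ (r ⨾ (r † ⨾ r)))  ≈⟨ ≈.refl ⟩⨾⟨ cancelInner (r † ⨾ r) r†r≈id ⟩
    r † ⨾ (r ⨾ (r † ⨾ r))                ≈⟨ assoc⁻¹ (r †) r _ ⟩
    (r † ⨾ r) ⨾ (r † ⨾ r)                ≈⟨ r†r≈id ⟩⨾⟨ r†r≈id ⟩
    id ⨾ id                              ≈⟨ identityˡ id ⟩
    id                                   ∎

  splitCore-factorises : ∀ {A B R Q} {f : A ⇒ B} {f° : B ⇒ A} {r : A ⇒ R} {q : B ⇒ Q} →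
                         IsMPInverse X f f° → f ⨾ f° ≈ r ⨾ r † → f° ⨾ f ≈ q ⨾ q † →
                         r ⨾ ((r † ⨾ (f ⨾ q)) ⨾ q †) ≈ f
  splitCore-factorises {f = f} {f°} {r} {q} (fgf , _) ff°≈rr† f°f≈qq† = begin
    r ⨾ ((r † ⨾ (f ⨾ q)) ⨾ q †)   ≈⟨ ≈.refl ⟩⨾⟨ assoc (r †) (f ⨾ q) (q †) ⟩
    r ⨾ (r † ⨾ ((f ⨾ q) ⨾ q †))   ≈⟨ assoc⁻¹ r (r †) _ ⟩
    (r ⨾ r †) ⨾ ((f ⨾ q) ⨾ q †)   ≈⟨ ≈.refl ⟩⨾⟨ assoc f q (q †) ⟩
    (r ⨾ r †) ⨾ (f ⨾ (q ⨾ q †))   ≈⟨ ≈.sym ff°≈rr† ⟩⨾⟨ ≈.refl ⟩⨾⟨ ≈.sym f°f≈qq† ⟩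
    (f ⨾ f°) ⨾ (f ⨾ (f° ⨾ f))     ≈⟨ ≈.refl ⟩⨾⟨ fgf ⟩
    (f ⨾ f°) ⨾ f                  ≈⟨ assoc f f° f ⟩
    f ⨾ (f° ⨾ f)                  ≈⟨ fgf ⟩
    f                             ∎

  MPSplit⇒gcsvd : ∀ {A B} {f : A ⇒ B} → IsMPSplit X f → HasGCSVD X f
  MPSplit⇒gcsvd {f = f} (f° , mp , (_ , r , ff°≈rr† , r-co) , (_ , q , f°f≈qq† , q-co)) =
    _ , _ , r , r † ⨾ (f ⨾ q) , q † , r-co ,
    (q † ⨾ (f° ⨾ r) ,
      splitCore-inverse ff°≈rr† f°f≈qq† r-co ,
      splitCore-inverse f°f≈qq† ff°≈rr† q-co) ,
    coisometry⇒†-isometry q-co ,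
    ≈.sym (splitCore-factorises mp ff°≈rr† f°f≈qq†)

mainTheorem13 : ∀ {o ℓ e : Level} (X : DaggerCategory o ℓ e) →
    MPComplete X ⇔ (∀ {A B} (f : DaggerCategory._⇒_ X A B) → HasGCSVD X f)
mainTheorem13 X = mk⇔ (λ complete {_} {_} f → MPSplit⇒gcsvd X (complete f))
                      (λ decompose {_} {_} f → gcsvd⇒MPSplit X (decompose f))
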